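{- Let $L\ge2$, $n\ge2$ be integers. For any integers $0\le g\le L-1$, $0\le t\le n-2$ and $0\le h_0<L^t$, $\xi_{gL^t+h_0}(K_L^n)-\xi_{gL^t}(K_L^n)\ge 0$.
   Context: $K_L^n$ is the graph on strings $x_n\cdots x_1$ over $\{0,\dots,L-1\}$, adjacent iff they differ in exactly one coordinate. For integers $N\ge1$ and $0\le m\le L^N$ with base-$L$ expansion $m=\sum_{i=0}^{s}a_iL^{b_i}$ ($a_i\in\{1,\dots,L-1\}$, $b_0>\dots>b_s\ge0$) let $ex_m(K_L^N)=\sum_{i=0}^{s}[(L-1)a_ib_iL^{b_i}+(a_i-1)a_iL^{b_i}]+2\sum_{i=0}^{s-1}\sum_{k=i+1}^{s}a_ia_kL^{b_k}$ ($ex_0=0$), and $\xi_m(K_L^N)=(L-1)Nm-ex_m(K_L^N)$. -}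

module Defs where

open import Data.Nat using (ℕ; zero; suc; _+_; _*_; _∸_; _^_; NonZero; _≟_)
open import Data.Nat.DivMod using (_/_; _%_)
open import Data.List using (List; []; _∷_; reverse)
open import Data.Product using (_×_; _,_)
open import Data.Integer as ℤ using (ℤ; +_)
open import Relation.Nullary using (yes; no)

-- Nonzero base-L digits of m, as pairs (a , b) meaning a * L ^ b,
-- listed in INCREASING exponent order; 'pos' is the exponent of the
-- current lowest digit, 'fuel' bounds the recursion (fuel = m suffices).
digitsAux : (L : ℕ) → .{{_ : NonZero L}} → (fuel pos m : ℕ) → List (ℕ × ℕ)
digitsAux L zero    pos m = []
digitsAux L (suc f) pos m with m % L ≟ 0
... | yes _ = digitsAux L f (suc pos) (m / L)
... | no  _ = (m % L , pos) ∷ digitsAux L f (suc pos) (m / L)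

-- The base-L expansion m = Σ_{i=0}^{s} a_i L^{b_i} with a_i ∈ {1..L-1}
-- and b_0 > b_1 > ... > b_s, as the list [(a_0,b_0), ..., (a_s,b_s)].
expansion : (L : ℕ) → .{{_ : NonZero L}} → ℕ → List (ℕ × ℕ)
expansion L m = reverse (digitsAux L (suc m) 0 m)

tailValue : ℕ → List (ℕ × ℕ) → ℕ
tailValue L [] = 0
tailValue L ((a , b) ∷ ds) = a * L ^ b + tailValue L ds

-- ex computed from the (decreasing-exponent) digit list:
-- Σ_i [(L-1) a_i b_i L^{b_i} + (a_i - 1) a_i L^{b_i}]
--   + 2 Σ_{i<k} a_i a_k L^{b_k}
exList : ℕ → List (ℕ × ℕ) → ℕ
exList L [] = 0
exList L ((a , b) ∷ ds) =
  ((L ∸ 1) * a * b * L ^ b + (a ∸ 1) * a * L ^ b)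
  + 2 * (a * tailValue L ds)
  + exList L ds

-- ex_m(K_L^N) (does not depend on N); ex_0 = 0 since expansion of 0 is empty
ex : (L : ℕ) → .{{_ : NonZero L}} → (N m : ℕ) → ℕ
ex L N m = exList L (expansion L m)

ξ : (L : ℕ) → .{{_ : NonZero L}} → (N m : ℕ) → ℤ
ξ L N m = (+ ((L ∸ 1) * N * m)) ℤ.- (+ ex L N m)

{-# OPTIONS --safe #-}
-- Writing m = g·L^t + h₀ with g the leading digit, the expansion of m is that of h₀ with the
-- digit (g, t) put in front, so ex_m = ex_{g L^t} + 2 g h₀ + ex_{h₀}. Hence the difference of
-- the two ξ's is (L-1) n h₀ − 2 g h₀ − ex_{h₀}. An induction on the number of digits gives
-- ex_h ≤ (L-1) t h for h < L^t, and with g ≤ L-1 and t + 2 ≤ n the difference is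
-- at least (L-1)(n - t - 2) h₀ ≥ 0.
module Submission where

open import Defs
open import Data.Nat using (ℕ; zero; suc; _+_; _*_; _∸_; _^_; _≤_; _<_; z≤n; s≤s; _≟_; NonZero)
open import Data.Integer as ℤ using (ℤ; +_)
open import Data.Nat.Properties
open import Data.Nat.DivMod
open import Data.Nat.Divisibility using (divides-refl)
open import Data.Nat.Tactic.RingSolver using (solve-∀)
open import Data.Integer.Properties using (pos-+; i≤j⇒0≤j-i)
import Data.Integer.Tactic.RingSolver as ℤ-Solver
open import Data.List using (List; []; _∷_; [_]; _++_; reverse)
open import Data.List.Properties using (reverse-++)
open import Data.Product using (_×_; _,_)
open import Relation.Nullary using (yes; no)
open import Relation.Binary.PropositionalEquality
  using (_≡_; refl; sym; trans; cong; cong₂; subst; module ≡-Reasoning)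

n<m^n : ∀ {m} → 1 < m → ∀ n → n < m ^ n
n<m^n 1<m zero = s≤s z≤n
n<m^n {m} 1<m (suc n) = ≤-<-trans (n<m^n 1<m n) (^-monoʳ-< m 1<m (n<1+n n))

[kn+m]%n≡m%n : ∀ k m n .{{_ : NonZero n}} → (k * n + m) % n ≡ m % n
[kn+m]%n≡m%n k m n = trans (cong (_% n) (+-comm (k * n) m)) ([m+kn]%n≡m%n m k n)

[kn+m]/n≡k+m/n : ∀ k m n .{{_ : NonZero n}} → (k * n + m) / n ≡ k + m / n
[kn+m]/n≡k+m/n k m n =
  trans (+-distrib-/-∣ˡ m (divides-refl k)) (cong (_+ m / n) (m*n/n≡m k n))

consDigit : ℕ → ℕ → List (ℕ × ℕ) → List (ℕ × ℕ)
consDigit zero    pos ds = ds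
consDigit (suc d) pos ds = (suc d , pos) ∷ ds

consDigit-pos : ∀ {d} → 0 < d → ∀ pos ds → consDigit d pos ds ≡ (d , pos) ∷ ds
consDigit-pos (s≤s _) pos ds = refl

consDigit-++ : ∀ d pos ds es → consDigit d pos ds ++ es ≡ consDigit d pos (ds ++ es)
consDigit-++ zero    pos ds es = refl
consDigit-++ (suc d) pos ds es = refl

-- The inductive step of the bound on ex: the left side is exList of the digit (suc d, t)
-- followed by digits of value r with ex e, where P stands for L^t.
leading-ex-≤ : ∀ {K d t P r e} → suc d ≤ K → r ≤ P → e ≤ K * t * r →
  ((K * suc d * t * P + d * suc d * P) + 2 * (suc d * r)) + e ≤ K * suc t * (suc d * P + r)
leading-ex-≤ {K} {d} {t} {P} {r} {e} g≤K r≤P e≤Ktr = begin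
  ((K * g * t * P + d * g * P) + 2 * (g * r)) + e      ≤⟨ +-monoʳ-≤ _ e≤Ktr ⟩
  ((K * g * t * P + d * g * P) + 2 * (g * r)) + K * t * r
                                                       ≡⟨ split-2gr K d t P r ⟩
  K * t * (g * P + r) + (d * g * P + g * r) + g * r
                                                       ≤⟨ +-monoʳ-≤ (K * t * (g * P + r) + (d * g * P + g * r))
                                                                    (*-monoʳ-≤ g r≤P) ⟩
  K * t * (g * P + r) + (d * g * P + g * r) + g * P    ≡⟨ collect-g K d t P r ⟩
  K * t * (g * P + r) + g * (g * P + r)                ≤⟨ +-monoʳ-≤ _ (*-monoˡ-≤ (g * P + r) g≤K) ⟩
  K * t * (g * P + r) + K * (g * P + r)                ≡⟨ collect-K K t (g * P + r) ⟩
  K * suc t * (g * P + r)                              ∎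
  where
  open ≤-Reasoning
  g : ℕ
  g = suc d
  split-2gr : ∀ K d t P r →
    ((K * suc d * t * P + d * suc d * P) + 2 * (suc d * r)) + K * t * r ≡
    K * t * (suc d * P + r) + (d * suc d * P + suc d * r) + suc d * r
  split-2gr = solve-∀
  collect-g : ∀ K d t P r →
    K * t * (suc d * P + r) + (d * suc d * P + suc d * r) + suc d * P ≡
    K * t * (suc d * P + r) + suc d * (suc d * P + r)
  collect-g = solve-∀
  collect-K : ∀ K t X → K * t * X + K * X ≡ K * suc t * X
  collect-K = solve-∀

module Digits (L : ℕ) .{{_ : NonZero L}} where

  digitsAux-suc : ∀ f pos m →
    digitsAux L (suc f) pos m ≡ consDigit (m % L) pos (digitsAux L f (suc pos) (m / L))
  digitsAux-suc f pos m with m % L ≟ 0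
  ... | yes m%L≡0 rewrite m%L≡0 = refl
  ... | no  m%L≢0 = sym (consDigit-pos (n≢0⇒n>0 m%L≢0) pos _)

  digitsAux-zero : ∀ f pos → digitsAux L f pos 0 ≡ []
  digitsAux-zero zero    pos = refl
  digitsAux-zero (suc f) pos = begin
    digitsAux L (suc f) pos 0
      ≡⟨ digitsAux-suc f pos 0 ⟩
    consDigit (0 % L) pos (digitsAux L f (suc pos) (0 / L))
      ≡⟨ cong₂ (λ d q → consDigit d pos (digitsAux L f (suc pos) q)) (m*n%n≡0 0 L) (0/n≡0 L) ⟩
    digitsAux L f (suc pos) 0
      ≡⟨ digitsAux-zero f (suc pos) ⟩
    []
      ∎
    where open ≡-Reasoning

  digitsAux-fuel-+ : ∀ f e pos m → m < L ^ f → digitsAux L (f + e) pos m ≡ digitsAux L f pos m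
  digitsAux-fuel-+ zero    e pos .0 (s≤s z≤n) = digitsAux-zero e pos
  digitsAux-fuel-+ (suc f) e pos m m<L^1+f
    rewrite digitsAux-suc (f + e) pos m | digitsAux-suc f pos m =
      cong (consDigit (m % L) pos) (digitsAux-fuel-+ f e (suc pos) (m / L) m/L<L^f)
    where
    m/L<L^f : m / L < L ^ f
    m/L<L^f = m<n*o⇒m/o<n (subst (m <_) (*-comm L (L ^ f)) m<L^1+f)

  digitsAux-fuel : ∀ f f' pos m → m < L ^ f → m < L ^ f' →
    digitsAux L f pos m ≡ digitsAux L f' pos m
  digitsAux-fuel f f' pos m m<L^f m<L^f' = begin
    digitsAux L f pos m         ≡⟨ digitsAux-fuel-+ f f' pos m m<L^f ⟨
    digitsAux L (f + f') pos m  ≡⟨ cong (λ e → digitsAux L e pos m) (+-comm f f') ⟩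
    digitsAux L (f' + f) pos m  ≡⟨ digitsAux-fuel-+ f' f pos m m<L^f' ⟩
    digitsAux L f' pos m        ∎
    where open ≡-Reasoning

  digitsAux-leading : ∀ t pos {g h} → 0 < g → g < L → h < L ^ t →
    digitsAux L (suc t) pos (g * L ^ t + h) ≡ digitsAux L t pos h ++ [ (g , pos + t) ]
  digitsAux-leading zero pos {g} {.0} 0<g g<L (s≤s z≤n) = begin
    digitsAux L 1 pos (g * 1 + 0)          ≡⟨ cong (digitsAux L 1 pos) g*1+0≡g ⟩
    digitsAux L 1 pos g                    ≡⟨ digitsAux-suc 0 pos g ⟩
    consDigit (g % L) pos []               ≡⟨ cong (λ d → consDigit d pos []) (m<n⇒m%n≡m g<L) ⟩
    consDigit g pos []                     ≡⟨ consDigit-pos 0<g pos [] ⟩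
    [ (g , pos) ]                          ≡⟨ cong (λ p → [ (g , p) ]) (+-identityʳ pos) ⟨
    [ (g , pos + 0) ]                      ∎
    where
    open ≡-Reasoning
    g*1+0≡g : g * 1 + 0 ≡ g
    g*1+0≡g = trans (+-identityʳ (g * 1)) (*-identityʳ g)
  digitsAux-leading (suc t) pos {g} {h} 0<g g<L h<L^1+t = begin
    digitsAux L (2 + t) pos m
      ≡⟨ digitsAux-suc (suc t) pos m ⟩
    consDigit (m % L) pos (digitsAux L (suc t) (suc pos) (m / L))
      ≡⟨ cong₂ (λ d q → consDigit d pos (digitsAux L (suc t) (suc pos) q)) m%L≡h%L m/L≡ ⟩
    consDigit (h % L) pos (digitsAux L (suc t) (suc pos) (g * L ^ t + h / L))
      ≡⟨ cong (consDigit (h % L) pos) (digitsAux-leading t (suc pos) 0<g g<L h/L<L^t) ⟩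
    consDigit (h % L) pos (digitsAux L t (suc pos) (h / L) ++ [ (g , suc pos + t) ])
      ≡⟨ consDigit-++ (h % L) pos _ _ ⟨
    consDigit (h % L) pos (digitsAux L t (suc pos) (h / L)) ++ [ (g , suc pos + t) ]
      ≡⟨ cong₂ (λ ds p → ds ++ [ (g , p) ]) (digitsAux-suc t pos h) (+-suc pos t) ⟨
    digitsAux L (suc t) pos h ++ [ (g , pos + suc t) ]
      ∎
    where
    open ≡-Reasoning
    m : ℕ
    m = g * L ^ suc t + h
    m≡ : m ≡ g * L ^ t * L + h
    m≡ = cong (_+ h) (trans (cong (g *_) (*-comm L (L ^ t))) (sym (*-assoc g (L ^ t) L)))
    m%L≡h%L : m % L ≡ h % L
    m%L≡h%L = trans (cong (_% L) m≡) ([kn+m]%n≡m%n (g * L ^ t) h L)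
    m/L≡ : m / L ≡ g * L ^ t + h / L
    m/L≡ = trans (cong (_/ L) m≡) ([kn+m]/n≡k+m/n (g * L ^ t) h L)
    h/L<L^t : h / L < L ^ t
    h/L<L^t = m<n*o⇒m/o<n (subst (h <_) (*-comm L (L ^ t)) h<L^1+t)

  leading<L^1+t : ∀ t {g h} → g < L → h < L ^ t → g * L ^ t + h < L ^ suc t
  leading<L^1+t t {g} {h} g<L h<L^t = begin-strict
    g * L ^ t + h      <⟨ +-monoʳ-< (g * L ^ t) h<L^t ⟩
    g * L ^ t + L ^ t  ≡⟨ +-comm (g * L ^ t) (L ^ t) ⟩
    suc g * L ^ t      ≤⟨ *-monoˡ-≤ (L ^ t) g<L ⟩
    L ^ suc t          ∎
    where open ≤-Reasoning

  data LeadingDigit (t : ℕ) : ℕ → Set where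
    leading : ∀ d r → d < L → r < L ^ t → LeadingDigit t (d * L ^ t + r)

  leadingDigit : ∀ t h → h < L ^ suc t → LeadingDigit t h
  leadingDigit t h h<L^1+t =
    subst (LeadingDigit t) (sym h≡) (leading (h / L ^ t) (h % L ^ t) h/L^t<L (m%n<n h (L ^ t)))
    where
    instance
      L^t≢0 : NonZero (L ^ t)
      L^t≢0 = m^n≢0 L t
    h≡ : h ≡ h / L ^ t * L ^ t + h % L ^ t
    h≡ = trans (m≡m%n+[m/n]*n h (L ^ t)) (+-comm (h % L ^ t) _)
    h/L^t<L : h / L ^ t < L
    h/L^t<L = m<n*o⇒m/o<n h<L^1+t

  module _ (1<L : 1 < L) where

    expansion-digitsAux : ∀ f m → m < L ^ f → expansion L m ≡ reverse (digitsAux L f 0 m)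
    expansion-digitsAux f m m<L^f =
      cong reverse (digitsAux-fuel (suc m) f 0 m (<-trans (n<1+n m) (n<m^n 1<L (suc m))) m<L^f)

    expansion-zero : expansion L 0 ≡ []
    expansion-zero = expansion-digitsAux 0 0 (s≤s z≤n)

    expansion-leading : ∀ t {g h} → 0 < g → g < L → h < L ^ t →
      expansion L (g * L ^ t + h) ≡ (g , t) ∷ expansion L h
    expansion-leading t {g} {h} 0<g g<L h<L^t = begin
      expansion L (g * L ^ t + h)
        ≡⟨ expansion-digitsAux (suc t) _ (leading<L^1+t t g<L h<L^t) ⟩
      reverse (digitsAux L (suc t) 0 (g * L ^ t + h))
        ≡⟨ cong reverse (digitsAux-leading t 0 0<g g<L h<L^t) ⟩
      reverse (digitsAux L t 0 h ++ [ (g , t) ])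
        ≡⟨ reverse-++ (digitsAux L t 0 h) [ (g , t) ] ⟩
      (g , t) ∷ reverse (digitsAux L t 0 h)
        ≡⟨ cong ((g , t) ∷_) (expansion-digitsAux t h h<L^t) ⟨
      (g , t) ∷ expansion L h
        ∎
      where open ≡-Reasoning

    tailValue-expansion : ∀ t h → h < L ^ t → tailValue L (expansion L h) ≡ h
    tailValue-expansion zero .0 (s≤s z≤n) rewrite expansion-zero = refl
    tailValue-expansion (suc t) h h<L^1+t with leadingDigit t h h<L^1+t
    ... | leading zero    r _   r<L^t = tailValue-expansion t r r<L^t
    ... | leading (suc d) r d<L r<L^t rewrite expansion-leading t (s≤s z≤n) d<L r<L^t =
      cong (_+_ (suc d * L ^ t)) (tailValue-expansion t r r<L^t)

    ex-≤ : ∀ N t h → h < L ^ t → ex L N h ≤ (L ∸ 1) * t * h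
    ex-≤ N zero .0 (s≤s z≤n) rewrite expansion-zero = z≤n
    ex-≤ N (suc t) h h<L^1+t with leadingDigit t h h<L^1+t
    ... | leading zero    r _   r<L^t =
      ≤-trans (ex-≤ N t r r<L^t) (*-monoˡ-≤ r (*-monoʳ-≤ (L ∸ 1) (n≤1+n t)))
    ... | leading (suc d) r d<L r<L^t
      rewrite expansion-leading t (s≤s z≤n) d<L r<L^t | tailValue-expansion t r r<L^t =
        leading-ex-≤ (∸-monoˡ-≤ 1 d<L) (<⇒≤ r<L^t) (ex-≤ N t r r<L^t)

    ex-leading : ∀ N t {g h} → g < L → h < L ^ t →
      ex L N (g * L ^ t + h) ≡ ex L N (g * L ^ t) + (2 * (g * h) + ex L N h)
    ex-leading N t {zero} _ _ rewrite expansion-zero = refl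
    ex-leading N t {g@(suc _)} {h} g<L h<L^t = begin
      ex L N (g * L ^ t + h)
        ≡⟨ cong (exList L) (expansion-leading t (s≤s z≤n) g<L h<L^t) ⟩
      (W + 2 * (g * tailValue L (expansion L h))) + ex L N h
        ≡⟨ cong (λ v → (W + 2 * (g * v)) + ex L N h) (tailValue-expansion t h h<L^t) ⟩
      (W + 2 * (g * h)) + ex L N h
        ≡⟨ regroup W g h (ex L N h) ⟩
      ((W + 2 * (g * 0)) + 0) + (2 * (g * h) + ex L N h)
        ≡⟨ cong (_+ (2 * (g * h) + ex L N h)) ex-gL^t ⟨
      ex L N (g * L ^ t) + (2 * (g * h) + ex L N h)
        ∎
      where
      open ≡-Reasoning
      W : ℕ
      W = (L ∸ 1) * g * t * L ^ t + (g ∸ 1) * g * L ^ t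
      ex-gL^t : ex L N (g * L ^ t) ≡ (W + 2 * (g * 0)) + 0
      ex-gL^t = begin
        exList L (expansion L (g * L ^ t))
          ≡⟨ cong (λ m → exList L (expansion L m)) (+-identityʳ (g * L ^ t)) ⟨
        exList L (expansion L (g * L ^ t + 0))
          ≡⟨ cong (exList L) (expansion-leading t (s≤s z≤n) g<L (m^n>0 L t)) ⟩
        exList L ((g , t) ∷ expansion L 0)
          ≡⟨ cong (λ ds → exList L ((g , t) ∷ ds)) expansion-zero ⟩
        (W + 2 * (g * 0)) + 0
          ∎
      regroup : ∀ W g h e → (W + 2 * (g * h)) + e ≡ ((W + 2 * (g * 0)) + 0) + (2 * (g * h) + e)
      regroup = solve-∀

ξ-increment : ∀ L .{{_ : NonZero L}} N m h y → ex L N (m + h) ≡ ex L N m + y →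
  ξ L N (m + h) ℤ.- ξ L N m ≡ + ((L ∸ 1) * N * h) ℤ.- + y
ξ-increment L N m h y ex-m+h = begin
  ξ L N (m + h) ℤ.- ξ L N m
    ≡⟨ cong₂ (λ u v → (+ u ℤ.- + v) ℤ.- ξ L N m) (*-distribˡ-+ c m h) ex-m+h ⟩
  (+ (c * m + c * h) ℤ.- + (ex L N m + y)) ℤ.- ξ L N m
    ≡⟨ cong₂ (λ u v → (u ℤ.- v) ℤ.- ξ L N m) (pos-+ (c * m) (c * h)) (pos-+ (ex L N m) y) ⟩
  ((+ (c * m) ℤ.+ + (c * h)) ℤ.- (+ ex L N m ℤ.+ + y)) ℤ.- (+ (c * m) ℤ.- + ex L N m)
    ≡⟨ cancel (+ (c * m)) (+ (c * h)) (+ ex L N m) (+ y) ⟩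
  + (c * h) ℤ.- + y
    ∎
  where
  open ≡-Reasoning
  c : ℕ
  c = (L ∸ 1) * N
  cancel : ∀ (a b x y : ℤ) → ((a ℤ.+ b) ℤ.- (x ℤ.+ y)) ℤ.- (a ℤ.- x) ≡ b ℤ.- y
  cancel = ℤ-Solver.solve-∀

mainTheorem4 : (L n : ℕ) .{{_ : NonZero L}} → 2 ≤ L → 2 ≤ n →
    (g t h₀ : ℕ) → g ≤ L ∸ 1 → t ≤ n ∸ 2 → h₀ < L ^ t →
    + 0 ℤ.≤ (ξ L n (g * L ^ t + h₀) ℤ.- ξ L n (g * L ^ t))
mainTheorem4 L n 2≤L 2≤n g t h₀ g≤L∸1 t≤n∸2 h₀<L^t =
  subst (+ 0 ℤ.≤_) (sym (ξ-increment L n (g * L ^ t) h₀ _ (ex-leading 2≤L n t g<L h₀<L^t)))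
        (i≤j⇒0≤j-i (ℤ.+≤+ increment-≤))
  where
  open Digits L
  open ≤-Reasoning
  g<L : g < L
  g<L = subst (_≤ L) (+-comm g 1) (m≤o∸n⇒m+n≤o g (≤-trans (s≤s z≤n) 2≤L) g≤L∸1)
  t+2≤n : t + 2 ≤ n
  t+2≤n = m≤o∸n⇒m+n≤o t 2≤n t≤n∸2
  collect : ∀ K t h → 2 * (K * h) + K * t * h ≡ K * (t + 2) * h
  collect = solve-∀
  increment-≤ : 2 * (g * h₀) + ex L n h₀ ≤ (L ∸ 1) * n * h₀
  increment-≤ = begin
    2 * (g * h₀) + ex L n h₀
      ≤⟨ +-mono-≤ (*-monoʳ-≤ 2 (*-monoˡ-≤ h₀ g≤L∸1)) (ex-≤ 2≤L n t h₀ h₀<L^t) ⟩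
    2 * ((L ∸ 1) * h₀) + (L ∸ 1) * t * h₀   ≡⟨ collect (L ∸ 1) t h₀ ⟩
    (L ∸ 1) * (t + 2) * h₀                  ≤⟨ *-monoˡ-≤ h₀ (*-monoʳ-≤ (L ∸ 1) t+2≤n) ⟩
    (L ∸ 1) * n * h₀                        ∎
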